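{- Let $n\geq 4$, $k\geq 5$, and let $f_1^{n,k},\dots,f_n^{n,k}$ be a valid dynamic task allocation with maximum switching cost at most $2$. Let $\vec v$ be a demand vector with at least four non-zero entries and let $t$ be a task of type 2 with respect to $\vec v$ with intermediate task $i$. Then task $i$ is of type 1 with respect to $\vec v$.
   Context: A demand vector for $n$ agents and $k$ tasks is $\vec v=(v_1,\dots,v_k)$ of non-negative integers summing to $n$. A valid dynamic task allocation is a family of functions $f_1^{n,k},\dots,f_n^{n,k}$ from demand vectors to $[k]$ such that for every $\vec v$ and task $j$, exactly $v_j$ agents $a$ have $f_a^{n,k}(\vec v)=j$. The switching cost of $(\vec v,\vec v')$ is the number of agents $a$ with $f_a^{n,k}(\vec v)\neq f_a^{n,k}(\vec v')$; the maximum switching cost is its maximum over pairs at $\ell_1$ distance $2$. $(\vec v_1,\vec v_2)$ is $(s,t)$-adjacent if $\vec v_2$ is obtained from $\vec v_1$ by moving one unit of demand from task $s$ to task $t\neq s$. Agent $a$ is $(i,j)$-mobile for $(\vec v_1,\vec v_2)$ if $f_a^{n,k}(\vec v_1)=i\neq j=f_a^{n,k}(\vec v_2)$. If $(\vec v_1,\vec v_2)$ is $(s,t)$-adjacent with switching cost $2$, its intermediate task is the task $i$ such that one agent is $(s,i)$-mobile and another is $(i,t)$-mobile. A task $t$ is of type 1 with respect to $\vec v$ if moving a unit of demand in $\vec v$ from any task to $t$ yields switching cost $1$. A task $t$ is of type 2 with respect to $\vec v$ if there exist a task $i$ and an agent $a$ such that moving a unit of demand in $\vec v$ from any task other than $i$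 to $t$ yields switching cost $2$, intermediate task $i$, and $(i,t)$-mobile agent $a$; $i$ is the intermediate task of $t$ with respect to $\vec v$. -}

module Defs where

open import Data.Nat using (ℕ; zero; suc; pred; _≤_; _≟_)
open import Data.Fin using (Fin) renaming (_≟_ to _≟ᶠ_)
open import Data.Vec using (Vec; lookup; updateAt; allFin; count; sum)
open import Data.Product using (Σ; _×_; ∃-syntax)
open import Relation.Nullary using (¬_; ¬?)
open import Relation.Binary.PropositionalEquality using (_≡_; _≢_)

Demand : ℕ → Set
Demand k = Vec ℕ k

IsDemand : ∀ {k} → ℕ → Demand k → Set
IsDemand n v = sum v ≡ n

Allocation : ℕ → ℕ → Set
Allocation n k = Fin n → Demand k → Fin k

load : ∀ {n k} → Allocation n k → Demand k → Fin k → ℕ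
load {n} f v j = count (λ a → f a v ≟ᶠ j) (allFin n)

Valid : ∀ {n k} → Allocation n k → Set
Valid {n} {k} f = ∀ (v : Demand k) → IsDemand n v → ∀ j → load f v j ≡ lookup v j

switchingCost : ∀ {n k} → Allocation n k → Demand k → Demand k → ℕ
switchingCost {n} f v v' = count (λ a → ¬? (f a v ≟ᶠ f a v')) (allFin n)

move : ∀ {k} → Demand k → Fin k → Fin k → Demand k
move v s t = updateAt (updateAt v s pred) t suc

Adjacent : ∀ {k} → Demand k → Demand k → Fin k → Fin k → Set
Adjacent v1 v2 s t = s ≢ t × 1 ≤ lookup v1 s × v2 ≡ move v1 s t

-- maximum switching cost at most c: over all pairs of demand vectors at
-- ℓ1 distance 2, i.e. all (s,t)-adjacent pairs of demand vectors
MaxSwitchingCostAtMost : ∀ {n k} → Allocation n k → ℕ → Set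
MaxSwitchingCostAtMost {n} {k} f c =
  ∀ (v1 v2 : Demand k) (s t : Fin k) → IsDemand n v1 → Adjacent v1 v2 s t →
  switchingCost f v1 v2 ≤ c

Mobile : ∀ {n k} → Allocation n k → Fin n → Demand k → Demand k → Fin k → Fin k → Set
Mobile f a v1 v2 i j = f a v1 ≡ i × f a v2 ≡ j × i ≢ j

IntermediateTask : ∀ {n k} → Allocation n k → Demand k → Demand k → Fin k → Fin k → Fin k → Set
IntermediateTask {n} f v1 v2 s t i =
  Σ (Fin n) λ b → Σ (Fin n) λ c → b ≢ c × Mobile f b v1 v2 s i × Mobile f c v1 v2 i t

Type1 : ∀ {n k} → Allocation n k → Demand k → Fin k → Set
Type1 {n} {k} f v t =
  ∀ (s : Fin k) → s ≢ t → 1 ≤ lookup v s → switchingCost f v (move v s t) ≡ 1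

Type2With : ∀ {n k} → Allocation n k → Demand k → Fin k → Fin k → Fin n → Set
Type2With {n} {k} f v t i a =
  ∀ (s : Fin k) → s ≢ i → s ≢ t → 1 ≤ lookup v s →
    switchingCost f v (move v s t) ≡ 2
    × IntermediateTask f v (move v s t) s t i
    × Mobile f a v (move v s t) i t

Type2 : ∀ {n k} → Allocation n k → Demand k → Fin k → Set
Type2 {n} {k} f v t = ∃[ i ] ∃[ a ] Type2With f v t i a

nonZeroEntries : ∀ {k} → Demand k → ℕ
nonZeroEntries v = count (λ x → ¬? (x ≟ 0)) v

-- Counting agents task by task, the agents that switch along an (s,t)-adjacent pair
-- change the load of every task exactly as the demand changes. So a pair of switching
-- cost 1 moves one agent from s to t, and one of cost 2 moves an agent from s to some m
-- and another from m to t. Every adjacent pair costs 1 or 2; suppose moving a unit from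
-- s to i costs 2, via m. If s ≠ t, the type-2 move s → t sends b from s to i and a from
-- i to t; the vectors after s → i and after s → t are (i,t)-adjacent, yet a, c (s → m)
-- and d (m → i) all switch between them. If s = t, take a fourth task s' ∉ {i, t, m} of
-- positive demand: by the first case s' → i costs 1, moving a single agent y, and the
-- vectors after s' → i and after t → i are (t,s')-adjacent, yet c, d and y all switch
-- between them.

module Submission where

open import Defs
open import Level using (Level)
open import Data.Nat
  using (ℕ; zero; suc; pred; _+_; _≤_; _<_; _≟_; z≤n; s≤s; z<s; s≤s⁻¹; >-nonZero)
open import Data.Nat.Properties
  using (+-comm; +-assoc; +-suc; +-identityʳ; +-cancelˡ-≡; +-cancelʳ-≡; +-monoˡ-≤; m≤n+m;
         suc-pred; 0≢1+n; n≮0; n≢0⇒n>0; ≤-trans; ≤-reflexive; <-≤-trans;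
         +-0-commutativeMonoid; +-commutativeSemigroup)
open import Algebra.Properties.CommutativeMonoid.Sum +-0-commutativeMonoid
  using (sum; sum-remove; sum-cong-≗; sum-replicate-zero)
open import Algebra.Properties.CommutativeSemigroup +-commutativeSemigroup
  using (xy∙z≈xz∙y; xy∙z≈zy∙x; xy∙z≈x∙zy)
open import Data.Fin using (Fin; zero; suc; punchIn) renaming (_≟_ to _≟ᶠ_)
open import Data.Fin.Properties using (any?; punchInᵢ≢i)
open import Data.Vec as Vec using (Vec; _∷_; lookup; tabulate; count; updateAt)
open import Data.Vec.Properties
  using (lookup∘updateAt; lookup∘updateAt′; tabulate∘lookup; tabulate-cong)
open import Data.Vec.Functional as Vector using (Vector)
open import Data.Vec.Functional.Properties using (updateAt-updates; updateAt-minimal)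
open import Data.Bool using (true; false; if_then_else_)
open import Data.Empty using (⊥; ⊥-elim)
open import Data.Product using (_×_; _,_; proj₁; proj₂; ∃; ∃-syntax)
open import Data.Sum using (_⊎_; inj₁; inj₂; [_,_]′)
open import Function using (_∘_; const; id)
open import Relation.Nullary using (¬_; Dec; yes; no; does; ¬?; contradiction)
open import Relation.Nullary.Decidable using (_×-dec_; decidable-stable)
open import Relation.Unary using (Pred; Decidable)
open import Relation.Binary.PropositionalEquality
  using (_≡_; _≢_; refl; sym; trans; cong; cong₂; subst; ≢-sym; module ≡-Reasoning)

private
  variable
    n : ℕ
    p : Level
    P : Pred (Fin n) p

𝟙 : ∀ {p} {P : Set p} → Dec P → ℕ
𝟙 P? = if does P? then 1 else 0

𝟙-yes : ∀ {p} {P : Set p} (P? : Dec P) → P → 𝟙 P? ≡ 1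
𝟙-yes (yes _) _ = refl
𝟙-yes (no ¬p) p = contradiction p ¬p

𝟙-no : ∀ {p} {P : Set p} (P? : Dec P) → ¬ P → 𝟙 P? ≡ 0
𝟙-no (yes p) ¬p = contradiction p ¬p
𝟙-no (no _) _ = refl

𝟙≤1 : ∀ {p} {P : Set p} (P? : Dec P) → 𝟙 P? ≤ 1
𝟙≤1 (yes _) = s≤s z≤n
𝟙≤1 (no _) = z≤n

𝟙-⇔ : ∀ {p q} {P : Set p} {Q : Set q} (P? : Dec P) (Q? : Dec Q) →
  (P → Q) → (Q → P) → 𝟙 P? ≡ 𝟙 Q?
𝟙-⇔ (yes _) (yes _) _ _ = refl
𝟙-⇔ (yes p) (no ¬q) to _ = contradiction (to p) ¬q
𝟙-⇔ (no ¬p) (yes q) _ from = contradiction (from q) ¬p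
𝟙-⇔ (no _) (no _) _ _ = refl

sum-updateAt-0 : ∀ {n} (φ : Vector ℕ n) y → sum φ ≡ φ y + sum (Vector.updateAt φ y (const 0))
sum-updateAt-0 {suc n} φ y = begin
  sum φ                                ≡⟨ sum-remove {i = y} φ ⟩
  φ y + sum (φ ∘ punchIn y)            ≡⟨ cong (φ y +_) (sum-cong-≗ φ≗φ₀) ⟩
  φ y + sum (φ₀ ∘ punchIn y)           ≡⟨ cong (λ z → φ y + (z + sum (φ₀ ∘ punchIn y)))
                                               (sym (updateAt-updates y φ)) ⟩
  φ y + (φ₀ y + sum (φ₀ ∘ punchIn y))  ≡⟨ cong (φ y +_) (sym (sum-remove {i = y} φ₀)) ⟩
  φ y + sum φ₀                         ∎
  where
  open ≡-Reasoning
  φ₀ = Vector.updateAt φ y (const 0)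
  φ≗φ₀ : ∀ x → φ (punchIn y x) ≡ φ₀ (punchIn y x)
  φ≗φ₀ x = sym (updateAt-minimal (punchIn y x) y φ (punchInᵢ≢i y x))

sum-agree-off : ∀ {φ ψ : Vector ℕ n} y → (∀ x → x ≢ y → φ x ≡ ψ x) →
  sum φ + ψ y ≡ sum ψ + φ y
sum-agree-off {φ = φ} {ψ} y agree = begin
  sum φ + ψ y             ≡⟨ cong (_+ ψ y) (sum-updateAt-0 φ y) ⟩
  φ y + sum φ₀ + ψ y      ≡⟨ cong (λ z → φ y + z + ψ y) (sum-cong-≗ same) ⟩
  φ y + sum ψ₀ + ψ y      ≡⟨ xy∙z≈zy∙x (φ y) (sum ψ₀) (ψ y) ⟩
  ψ y + sum ψ₀ + φ y      ≡⟨ cong (_+ φ y) (sym (sum-updateAt-0 ψ y)) ⟩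
  sum ψ + φ y             ∎
  where
  open ≡-Reasoning
  φ₀ = Vector.updateAt φ y (const 0)
  ψ₀ = Vector.updateAt ψ y (const 0)
  same : ∀ x → φ₀ x ≡ ψ₀ x
  same x with x ≟ᶠ y
  ... | yes refl = trans (updateAt-updates y φ) (sym (updateAt-updates y ψ))
  ... | no x≢y = trans (updateAt-minimal x y φ x≢y)
                   (trans (agree x x≢y) (sym (updateAt-minimal x y ψ x≢y)))

-- Interpolate through χ, which agrees with φ off y₁ and with ψ off y₂.
sum-agree-off₂ : ∀ {φ ψ : Vector ℕ n} {y₁ y₂} → y₁ ≢ y₂ →
  (∀ x → x ≢ y₁ → x ≢ y₂ → φ x ≡ ψ x) →
  sum φ + (ψ y₁ + ψ y₂) ≡ sum ψ + (φ y₁ + φ y₂)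
sum-agree-off₂ {φ = φ} {ψ} {y₁} {y₂} y₁≢y₂ agree = begin
  sum φ + (ψ y₁ + ψ y₂)   ≡⟨ sym (+-assoc (sum φ) (ψ y₁) (ψ y₂)) ⟩
  sum φ + ψ y₁ + ψ y₂     ≡⟨ cong (λ z → sum φ + z + ψ y₂) (sym (updateAt-updates y₁ φ)) ⟩
  sum φ + χ y₁ + ψ y₂     ≡⟨ cong (_+ ψ y₂) (sum-agree-off y₁ φ≈χ) ⟩
  sum χ + φ y₁ + ψ y₂     ≡⟨ xy∙z≈xz∙y (sum χ) (φ y₁) (ψ y₂) ⟩
  sum χ + ψ y₂ + φ y₁     ≡⟨ cong (_+ φ y₁) (sum-agree-off y₂ χ≈ψ) ⟩
  sum ψ + χ y₂ + φ y₁     ≡⟨ cong (λ z → sum ψ + z + φ y₁) (sym (φ≈χ y₂ (≢-sym y₁≢y₂))) ⟩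
  sum ψ + φ y₂ + φ y₁     ≡⟨ xy∙z≈x∙zy (sum ψ) (φ y₂) (φ y₁) ⟩
  sum ψ + (φ y₁ + φ y₂)   ∎
  where
  open ≡-Reasoning
  χ = Vector.updateAt φ y₁ (const (ψ y₁))
  φ≈χ : ∀ x → x ≢ y₁ → φ x ≡ χ x
  φ≈χ x x≢y₁ = sym (updateAt-minimal x y₁ φ x≢y₁)
  χ≈ψ : ∀ x → x ≢ y₂ → χ x ≡ ψ x
  χ≈ψ x x≢y₂ with x ≟ᶠ y₁
  ... | yes refl = updateAt-updates y₁ φ
  ... | no x≢y₁ = trans (sym (φ≈χ x x≢y₁)) (agree x x≢y₁ x≢y₂)

# : Decidable P → ℕ
# P? = sum (λ x → 𝟙 (P? x))

infixl 6 _∖_ _∖?_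

_∖_ : Pred (Fin n) p → Fin n → Pred (Fin n) p
(P ∖ y) x = P x × x ≢ y

_∖?_ : Decidable P → ∀ y → Decidable (P ∖ y)
(P? ∖? y) x = P? x ×-dec ¬? (x ≟ᶠ y)

count-tabulate : ∀ {a n p} {A : Set a} {P : Pred A p} (P? : Decidable P) (g : Fin n → A) →
  count P? (tabulate g) ≡ # (P? ∘ g)
count-tabulate {n = zero} P? g = refl
count-tabulate {n = suc n} P? g with does (P? (g zero))
... | true = cong suc (count-tabulate P? (g ∘ suc))
... | false = count-tabulate P? (g ∘ suc)

#-remove : (P? : Decidable P) → ∀ y → # P? ≡ 𝟙 (P? y) + # (P? ∖? y)
#-remove P? y = trans (sum-updateAt-0 (λ x → 𝟙 (P? x)) y) (cong (𝟙 (P? y) +_) (sum-cong-≗ removed))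
  where
  φ = λ x → 𝟙 (P? x)
  removed-at : ∀ x → Dec (x ≡ y) → Vector.updateAt φ y (const 0) x ≡ 𝟙 ((P? ∖? y) x)
  removed-at x (yes refl) =
    trans (updateAt-updates y φ) (sym (𝟙-no ((P? ∖? y) y) λ (_ , y≢y) → y≢y refl))
  removed-at x (no x≢y) =
    trans (updateAt-minimal x y φ x≢y) (𝟙-⇔ (P? x) ((P? ∖? y) x) (_, x≢y) (λ (px , _) → px))
  removed : ∀ x → Vector.updateAt φ y (const 0) x ≡ 𝟙 ((P? ∖? y) x)
  removed x = removed-at x (x ≟ᶠ y)

#-remove-∈ : (P? : Decidable P) → ∀ {y} → P y → # P? ≡ suc (# (P? ∖? y))
#-remove-∈ P? {y} py = trans (#-remove P? y) (cong (_+ # (P? ∖? y)) (𝟙-yes (P? y) py))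

#-remove-≥ : (P? : Decidable P) → ∀ {m} y → suc m ≤ # P? → m ≤ # (P? ∖? y)
#-remove-≥ P? y 1+m≤# =
  s≤s⁻¹ (≤-trans 1+m≤# (≤-trans (≤-reflexive (#-remove P? y)) (+-monoˡ-≤ _ (𝟙≤1 (P? y)))))

∈⇒#-pos : (P? : Decidable P) → ∀ {y} → P y → 0 < # P?
∈⇒#-pos P? py = subst (0 <_) (sym (#-remove-∈ P? py)) z<s

#≡0⇒∁ : (P? : Decidable P) → # P? ≡ 0 → ∀ {x} → ¬ P x
#≡0⇒∁ P? #≡0 px = n≮0 (subst (0 <_) #≡0 (∈⇒#-pos P? px))

#-pos⇒∃ : (P? : Decidable P) → 0 < # P? → ∃ P
#-pos⇒∃ {n} P? 0<# with any? P?
... | yes ∃p = ∃p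
... | no ∄p = contradiction (subst (0 <_) (trans (sum-cong-≗ none) (sum-replicate-zero n)) 0<#) n≮0
  where
  none : ∀ x → 𝟙 (P? x) ≡ 0
  none x = 𝟙-no (P? x) λ px → ∄p (x , px)

#≤1⇒unique : (P? : Decidable P) → # P? ≤ 1 → ∀ {x y} → P x → P y → x ≡ y
#≤1⇒unique P? #≤1 {x} {y} px py with x ≟ᶠ y
... | yes x≡y = x≡y
... | no x≢y = contradiction (<-≤-trans (∈⇒#-pos (P? ∖? y) (px , x≢y)) #∖y≤0) n≮0
  where
  #∖y≤0 : # (P? ∖? y) ≤ 0
  #∖y≤0 = s≤s⁻¹ (subst (_≤ 1) (#-remove-∈ P? py) #≤1)

#≤2⇒among : (P? : Decidable P) → # P? ≤ 2 →
  ∀ {y₁ y₂} → y₁ ≢ y₂ → P y₁ → P y₂ → ∀ {x} → P x → x ≡ y₁ ⊎ x ≡ y₂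
#≤2⇒among P? #≤2 {y₁} {y₂} y₁≢y₂ py₁ py₂ {x} px with x ≟ᶠ y₁
... | yes x≡y₁ = inj₁ x≡y₁
... | no x≢y₁ = inj₂ (#≤1⇒unique (P? ∖? y₁) (s≤s⁻¹ (subst (_≤ 2) (#-remove-∈ P? py₁) #≤2))
                        (px , x≢y₁) (py₂ , ≢-sym y₁≢y₂))

#>1⇒∃₂ : (P? : Decidable P) → 1 < # P? → ∃[ y₁ ] ∃[ y₂ ] y₁ ≢ y₂ × P y₁ × P y₂
#>1⇒∃₂ P? 1<# with #-pos⇒∃ P? (<-≤-trans z<s 1<#)
... | y₁ , py₁ with #-pos⇒∃ (P? ∖? y₁) (s≤s⁻¹ (subst (1 <_) (#-remove-∈ P? py₁) 1<#))
... | y₂ , py₂ , y₂≢y₁ = y₁ , y₂ , ≢-sym y₂≢y₁ , py₁ , py₂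

δ : ∀ {k} → Fin k → Fin k → ℕ
δ x y = 𝟙 (x ≟ᶠ y)

δ-refl : ∀ {k} (x : Fin k) → δ x x ≡ 1
δ-refl x = 𝟙-yes (x ≟ᶠ x) refl

δ-≢ : ∀ {k} {x y : Fin k} → x ≢ y → δ x y ≡ 0
δ-≢ {x = x} {y} = 𝟙-no (x ≟ᶠ y)

δ-pos⇒≡ : ∀ {k} {x y : Fin k} → 0 < δ x y → x ≡ y
δ-pos⇒≡ {x = x} {y} 0<δ with x ≟ᶠ y
... | yes x≡y = x≡y
... | no _ = contradiction 0<δ n≮0

δ-injective : ∀ {k} {a b : Fin k} → (∀ j → δ a j ≡ δ b j) → a ≡ b
δ-injective {b = b} eq = δ-pos⇒≡ (subst (0 <_) (sym (trans (eq b) (δ-refl b))) z<s)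

δ-pair-cross : ∀ {k} {a b c d : Fin k} → (∀ j → δ a j + δ b j ≡ δ c j + δ d j) → a ≢ c →
  d ≡ a × b ≡ c
δ-pair-cross {a = a} {b} {c} {d} eq a≢c = d≡a , δ-injective δb≡δc
  where
  d≡a : d ≡ a
  d≡a = δ-pos⇒≡ (subst (0 <_) (begin
    suc (δ b a)         ≡⟨ cong (_+ δ b a) (sym (δ-refl a)) ⟩
    δ a a + δ b a       ≡⟨ eq a ⟩
    δ c a + δ d a       ≡⟨ cong (_+ δ d a) (δ-≢ (≢-sym a≢c)) ⟩
    δ d a               ∎) z<s)
    where open ≡-Reasoning
  δb≡δc : ∀ j → δ b j ≡ δ c j
  δb≡δc j = +-cancelˡ-≡ (δ a j) _ _
    (trans (eq j) (trans (+-comm (δ c j) (δ d j)) (cong (λ x → δ x j + δ c j) d≡a)))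

-- Agents moving g₁ → h₁ and g₂ → h₂ realise a unit move p → q;
-- once h₂ = q they chain up as p → h₁ → q.
δ-chain : ∀ {k} {p q g₁ h₁ g₂ h₂ : Fin k} → p ≢ q → g₁ ≢ h₁ →
  (∀ j → δ g₁ j + δ g₂ j + δ q j ≡ δ h₁ j + δ h₂ j + δ p j) →
  h₂ ≡ q → g₁ ≡ p × g₂ ≡ h₁
δ-chain {p = p} {q} {g₁} {h₁} {g₂} p≢q g₁≢h₁ eq refl with δ-pair-cross pair g₁≢h₁
  where
  pair : ∀ j → δ g₁ j + δ g₂ j ≡ δ h₁ j + δ p j
  pair j = +-cancelʳ-≡ (δ q j) _ _ (trans (eq j) (xy∙z≈xz∙y (δ h₁ j) (δ q j) (δ p j)))
... | p≡g₁ , g₂≡h₁ = sym p≡g₁ , g₂≡h₁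

δ-target : ∀ {k} {p q g₁ h₁ g₂ h₂ : Fin k} → p ≢ q →
  (∀ j → δ g₁ j + δ g₂ j + δ q j ≡ δ h₁ j + δ h₂ j + δ p j) → h₁ ≡ q ⊎ h₂ ≡ q
δ-target {p = p} {q} {g₁} {h₁} {g₂} {h₂} p≢q eq with h₂ ≟ᶠ q
... | yes h₂≡q = inj₂ h₂≡q
... | no h₂≢q = inj₁ (δ-pos⇒≡ (≤-trans (m≤n+m 1 (δ g₁ q + δ g₂ q)) (≤-reflexive (begin
    δ g₁ q + δ g₂ q + 1           ≡⟨ cong (δ g₁ q + δ g₂ q +_) (sym (δ-refl q)) ⟩
    δ g₁ q + δ g₂ q + δ q q       ≡⟨ eq q ⟩
    δ h₁ q + δ h₂ q + δ p q       ≡⟨ cong₂ (λ x y → δ h₁ q + x + y) (δ-≢ h₂≢q) (δ-≢ p≢q) ⟩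
    δ h₁ q + 0 + 0                ≡⟨ cong (_+ 0) (+-identityʳ _) ⟩
    δ h₁ q + 0                    ≡⟨ +-identityʳ _ ⟩
    δ h₁ q                        ∎))))
  where open ≡-Reasoning

lookup-ext : ∀ {k} {x y : Vec ℕ k} → (∀ j → lookup x j ≡ lookup y j) → x ≡ y
lookup-ext {x = x} {y} eq = trans (sym (tabulate∘lookup x)) (trans (tabulate-cong eq) (tabulate∘lookup y))

module _ {k} (v : Demand k) {p q : Fin k} (p≢q : p ≢ q) where

  lookup-move-to : lookup (move v p q) q ≡ suc (lookup v q)
  lookup-move-to =
    trans (lookup∘updateAt q (updateAt v p pred)) (cong suc (lookup∘updateAt′ q p (≢-sym p≢q) v))

  lookup-move-to-pos : 1 ≤ lookup (move v p q) q
  lookup-move-to-pos = subst (1 ≤_) (sym lookup-move-to) (s≤s z≤n)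

  lookup-move-from : lookup (move v p q) p ≡ pred (lookup v p)
  lookup-move-from = trans (lookup∘updateAt′ p q p≢q (updateAt v p pred)) (lookup∘updateAt p v)

  lookup-move-other : ∀ {j} → j ≢ p → j ≢ q → lookup (move v p q) j ≡ lookup v j
  lookup-move-other {j} j≢p j≢q =
    trans (lookup∘updateAt′ j q j≢q (updateAt v p pred)) (lookup∘updateAt′ j p j≢p v)

  move-balance : 1 ≤ lookup v p → ∀ j → lookup (move v p q) j + δ p j ≡ lookup v j + δ q j
  move-balance 1≤vp j with j ≟ᶠ p | j ≟ᶠ q
  ... | yes refl | _ = begin
    lookup (move v j q) j + δ j j  ≡⟨ cong₂ _+_ lookup-move-from (δ-refl j) ⟩
    pred (lookup v j) + 1          ≡⟨ +-comm (pred (lookup v j)) 1 ⟩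
    suc (pred (lookup v j))        ≡⟨ suc-pred (lookup v j) ⦃ >-nonZero 1≤vp ⦄ ⟩
    lookup v j                     ≡⟨ sym (+-identityʳ _) ⟩
    lookup v j + 0                 ≡⟨ cong (lookup v j +_) (sym (δ-≢ (≢-sym p≢q))) ⟩
    lookup v j + δ q j             ∎
    where open ≡-Reasoning
  ... | no j≢p | yes refl = begin
    lookup (move v p j) j + δ p j  ≡⟨ cong₂ _+_ lookup-move-to (δ-≢ p≢q) ⟩
    suc (lookup v j) + 0           ≡⟨ +-identityʳ _ ⟩
    suc (lookup v j)               ≡⟨ +-comm 1 (lookup v j) ⟩
    lookup v j + 1                 ≡⟨ cong (lookup v j +_) (sym (δ-refl j)) ⟩
    lookup v j + δ j j             ∎
    where open ≡-Reasoning
  ... | no j≢p | no j≢q =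
    cong₂ _+_ (lookup-move-other j≢p j≢q) (trans (δ-≢ (≢-sym j≢p)) (sym (δ-≢ (≢-sym j≢q))))

balance-trans : ∀ w u v {a b c : ℕ} → w + b ≡ u + c → u + a ≡ v + b → w + a ≡ v + c
balance-trans w u v {a} {b} {c} wu uv = +-cancelʳ-≡ b _ _ (begin
  w + a + b  ≡⟨ xy∙z≈xz∙y w a b ⟩
  w + b + a  ≡⟨ cong (_+ a) wu ⟩
  u + c + a  ≡⟨ xy∙z≈xz∙y u c a ⟩
  u + a + c  ≡⟨ cong (_+ c) uv ⟩
  v + b + c  ≡⟨ xy∙z≈xz∙y v b c ⟩
  v + c + b  ∎)
  where open ≡-Reasoning

difference-cancel : ∀ x y {a b c d : ℕ} → x + a ≡ y + b → x + c ≡ y + d → a + d ≡ b + c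
difference-cancel x y {a} {b} {c} {d} xa≡yb xc≡yd = +-cancelˡ-≡ x _ _ (begin
  x + (a + d)  ≡⟨ sym (+-assoc x a d) ⟩
  x + a + d    ≡⟨ cong (_+ d) xa≡yb ⟩
  y + b + d    ≡⟨ xy∙z≈xz∙y y b d ⟩
  y + d + b    ≡⟨ cong (_+ b) (sym xc≡yd) ⟩
  x + c + b    ≡⟨ +-assoc x c b ⟩
  x + (c + b)  ≡⟨ cong (x +_) (+-comm c b) ⟩
  x + (b + c)  ∎)
  where open ≡-Reasoning

balance⇒move : ∀ {k} {u v : Demand k} {p q} → p ≢ q → 1 ≤ lookup v p →
  (∀ j → lookup u j + δ p j ≡ lookup v j + δ q j) → u ≡ move v p q
balance⇒move {v = v} {p} p≢q 1≤vp eq = lookup-ext λ j →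
  +-cancelʳ-≡ (δ p j) _ _ (trans (eq j) (sym (move-balance v p≢q 1≤vp j)))

module _ {k} (v : Demand k) {s i t : Fin k} where

  move-move-trans : s ≢ i → i ≢ t → s ≢ t → 1 ≤ lookup v s →
    move (move v s i) i t ≡ move v s t
  move-move-trans s≢i i≢t s≢t 1≤vs = balance⇒move s≢t 1≤vs λ j →
    balance-trans (lookup (move (move v s i) i t) j) (lookup (move v s i) j) (lookup v j)
      (move-balance (move v s i) i≢t (lookup-move-to-pos v s≢i) j) (move-balance v s≢i 1≤vs j)

  move-then-refill : s ≢ i → t ≢ s → t ≢ i → 1 ≤ lookup v s → 1 ≤ lookup v t →
    move (move v s i) t s ≡ move v t i
  move-then-refill s≢i t≢s t≢i 1≤vs 1≤vt = balance⇒move t≢i 1≤vt λ j →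
    trans (move-balance (move v s i) t≢s 1≤ut j) (move-balance v s≢i 1≤vs j)
    where
    1≤ut : 1 ≤ lookup (move v s i) t
    1≤ut = subst (1 ≤_) (sym (lookup-move-other v s≢i t≢s t≢i)) 1≤vt

sum-updateAt-suc : ∀ {k} (x : Vec ℕ k) q → Vec.sum (updateAt x q suc) ≡ suc (Vec.sum x)
sum-updateAt-suc (x ∷ xs) zero = refl
sum-updateAt-suc (x ∷ xs) (suc q) = trans (cong (x +_) (sum-updateAt-suc xs q)) (+-suc x (Vec.sum xs))

sum-updateAt-pred : ∀ {k} (x : Vec ℕ k) p → 1 ≤ lookup x p →
  suc (Vec.sum (updateAt x p pred)) ≡ Vec.sum x
sum-updateAt-pred (suc x ∷ xs) zero _ = refl
sum-updateAt-pred (x ∷ xs) (suc p) 1≤xp =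
  trans (sym (+-suc x _)) (cong (x +_) (sum-updateAt-pred xs p 1≤xp))

Adjacent⇒IsDemand : ∀ {n k} {v u : Demand k} {p q} → IsDemand n v → Adjacent v u p q → IsDemand n u
Adjacent⇒IsDemand {v = v} {p = p} {q} dv (_ , 1≤vp , refl) =
  trans (sum-updateAt-suc (updateAt v p pred) q) (trans (sum-updateAt-pred v p 1≤vp) dv)

adjacent-balance : ∀ {k} {v u : Demand k} {p q} → Adjacent v u p q →
  ∀ j → lookup u j + δ p j ≡ lookup v j + δ q j
adjacent-balance {v = v} (p≢q , 1≤vp , refl) = move-balance v p≢q 1≤vp

Switches : ∀ {n k} → Allocation n k → Demand k → Demand k → Pred (Fin n) _
Switches f v u x = f x v ≢ f x u

switches? : ∀ {n k} (f : Allocation n k) v u → Decidable (Switches f v u)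
switches? f v u x = ¬? (f x v ≟ᶠ f x u)

switchingCost≡# : ∀ {n k} (f : Allocation n k) v u → switchingCost f v u ≡ # (switches? f v u)
switchingCost≡# f v u = count-tabulate (switches? f v u) id

Mobile⇒Switches : ∀ {n k} (f : Allocation n k) {x v u i j} → Mobile f x v u i j → Switches f v u x
Mobile⇒Switches f (fxv≡i , fxu≡j , i≢j) fxv≡fxu =
  i≢j (trans (sym fxv≡i) (trans fxv≡fxu fxu≡j))

others-stay : ∀ {n k} (f : Allocation n k) {v u y₁ y₂} →
  (∀ {x} → Switches f v u x → x ≡ y₁ ⊎ x ≡ y₂) →
  ∀ {x} → x ≢ y₁ → x ≢ y₂ → f x v ≡ f x u
others-stay f {v} {u} only {x} x≢y₁ x≢y₂ =
  decidable-stable (f x v ≟ᶠ f x u) λ sw → [ x≢y₁ , x≢y₂ ]′ (only sw)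

module _ {n k} {f : Allocation n k} (valid : Valid f) {v u : Demand k} {p q : Fin k}
         (dv : IsDemand n v) (adj : Adjacent v u p q) where

  private
    load-sum : ∀ {w} → IsDemand n w → ∀ j → sum (λ x → δ (f x w) j) ≡ lookup w j
    load-sum {w} dw j = trans (sym (count-tabulate (λ x → f x w ≟ᶠ j) id)) (valid _ dw j)

    du : IsDemand n u
    du = Adjacent⇒IsDemand dv adj

    p≢q : p ≢ q
    p≢q = proj₁ adj

  switchingCost≢0 : switchingCost f v u ≢ 0
  switchingCost≢0 cost≡0 = 0≢1+n (+-cancelˡ-≡ (lookup u q) _ _ (begin
    lookup u q + 0        ≡⟨ cong (lookup u q +_) (sym (δ-≢ p≢q)) ⟩
    lookup u q + δ p q    ≡⟨ adjacent-balance adj q ⟩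
    lookup v q + δ q q    ≡⟨ cong₂ _+_ same-load (δ-refl q) ⟩
    lookup u q + 1        ∎))
    where
    open ≡-Reasoning
    #≡0 : # (switches? f v u) ≡ 0
    #≡0 = trans (sym (switchingCost≡# f v u)) cost≡0
    nobody-switches : ∀ x → δ (f x v) q ≡ δ (f x u) q
    nobody-switches x = cong (λ y → δ y q)
      (decidable-stable (f x v ≟ᶠ f x u) (#≡0⇒∁ (switches? f v u) #≡0))
    same-load : lookup v q ≡ lookup u q
    same-load = trans (sym (load-sum dv q)) (trans (sum-cong-≗ nobody-switches) (load-sum du q))

  one-switcher-balance : ∀ {y} → (∀ {x} → Switches f v u x → x ≡ y) →
    ∀ j → δ (f y v) j + δ q j ≡ δ (f y u) j + δ p j
  one-switcher-balance {y} only j =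
    difference-cancel (lookup u j) (lookup v j) {b = δ (f y u) j} (begin
    lookup u j + δ (f y v) j                 ≡⟨ cong (_+ δ (f y v) j) (sym (load-sum du j)) ⟩
    sum (λ x → δ (f x u) j) + δ (f y v) j    ≡⟨ sum-agree-off y agree ⟩
    sum (λ x → δ (f x v) j) + δ (f y u) j    ≡⟨ cong (_+ δ (f y u) j) (load-sum dv j) ⟩
    lookup v j + δ (f y u) j                 ∎) (adjacent-balance adj j)
    where
    open ≡-Reasoning
    agree : ∀ x → x ≢ y → δ (f x u) j ≡ δ (f x v) j
    agree x x≢y = cong (λ z → δ z j) (sym (others-stay f (inj₁ ∘ only) x≢y x≢y))

  two-switchers-balance : ∀ {y₁ y₂} → y₁ ≢ y₂ →
    (∀ {x} → Switches f v u x → x ≡ y₁ ⊎ x ≡ y₂) →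
    ∀ j → δ (f y₁ v) j + δ (f y₂ v) j + δ q j ≡ δ (f y₁ u) j + δ (f y₂ u) j + δ p j
  two-switchers-balance {y₁} {y₂} y₁≢y₂ only j =
    difference-cancel (lookup u j) (lookup v j) {b = δ (f y₁ u) j + δ (f y₂ u) j} (begin
    lookup u j + (δ (f y₁ v) j + δ (f y₂ v) j)               ≡⟨ cong (_+ _) (sym (load-sum du j)) ⟩
    sum (λ x → δ (f x u) j) + (δ (f y₁ v) j + δ (f y₂ v) j)   ≡⟨ sum-agree-off₂ y₁≢y₂ agree ⟩
    sum (λ x → δ (f x v) j) + (δ (f y₁ u) j + δ (f y₂ u) j)   ≡⟨ cong (_+ _) (load-sum dv j) ⟩
    lookup v j + (δ (f y₁ u) j + δ (f y₂ u) j)                ∎) (adjacent-balance adj j)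
    where
    open ≡-Reasoning
    agree : ∀ x → x ≢ y₁ → x ≢ y₂ → δ (f x u) j ≡ δ (f x v) j
    agree x x≢y₁ x≢y₂ = cong (λ z → δ z j) (sym (others-stay f only x≢y₁ x≢y₂))

  switchingCost≡1⇒mobile : switchingCost f v u ≡ 1 →
    ∃[ y ] Mobile f y v u p q × (∀ {x} → Switches f v u x → x ≡ y)
  switchingCost≡1⇒mobile cost≡1 = mobile (#-pos⇒∃ sw? (≤-reflexive (sym #≡1)))
    where
    sw? = switches? f v u
    #≡1 : # sw? ≡ 1
    #≡1 = trans (sym (switchingCost≡# f v u)) cost≡1
    mobile : ∃ (Switches f v u) →
      ∃[ y ] Mobile f y v u p q × (∀ {x} → Switches f v u x → x ≡ y)
    mobile (y , y-sw) = y , (sym (proj₁ crossing) , sym (proj₂ crossing) , p≢q) , only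
      where
      only : ∀ {x} → Switches f v u x → x ≡ y
      only x-sw = #≤1⇒unique sw? (≤-reflexive #≡1) x-sw y-sw
      crossing : p ≡ f y v × q ≡ f y u
      crossing = δ-pair-cross (one-switcher-balance only) y-sw

  switchingCost≡2⇒intermediate : switchingCost f v u ≡ 2 → ∃[ m ] IntermediateTask f v u p q m
  switchingCost≡2⇒intermediate cost≡2 = from-pair (#>1⇒∃₂ sw? (≤-reflexive (sym #≡2)))
    where
    sw? = switches? f v u
    #≡2 : # sw? ≡ 2
    #≡2 = trans (sym (switchingCost≡# f v u)) cost≡2
    balance : ∀ {y₁ y₂} → y₁ ≢ y₂ → Switches f v u y₁ → Switches f v u y₂ →
      ∀ j → δ (f y₁ v) j + δ (f y₂ v) j + δ q j ≡ δ (f y₁ u) j + δ (f y₂ u) j + δ p j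
    balance y₁≢y₂ y₁-sw y₂-sw =
      two-switchers-balance y₁≢y₂ (#≤2⇒among sw? (≤-reflexive #≡2) y₁≢y₂ y₁-sw y₂-sw)
    chain : ∀ {y₁ y₂} → y₁ ≢ y₂ → Switches f v u y₁ → Switches f v u y₂ → f y₂ u ≡ q →
      ∃[ m ] IntermediateTask f v u p q m
    chain {y₁} {y₂} y₁≢y₂ y₁-sw y₂-sw fy₂u≡q
      with δ-chain {g₂ = f y₂ v} p≢q y₁-sw (balance y₁≢y₂ y₁-sw y₂-sw) fy₂u≡q
    ... | fy₁v≡p , fy₂v≡fy₁u =
      f y₁ u , y₁ , y₂ , y₁≢y₂ , (fy₁v≡p , refl , p≢m) , (fy₂v≡fy₁u , fy₂u≡q , m≢q)
      where
      p≢m : p ≢ f y₁ u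
      p≢m p≡m = y₁-sw (trans fy₁v≡p p≡m)
      m≢q : f y₁ u ≢ q
      m≢q m≡q = y₂-sw (trans fy₂v≡fy₁u (trans m≡q (sym fy₂u≡q)))
    from-pair : ∃[ y₁ ] ∃[ y₂ ] y₁ ≢ y₂ × Switches f v u y₁ × Switches f v u y₂ →
      ∃[ m ] IntermediateTask f v u p q m
    from-pair (y₁ , y₂ , y₁≢y₂ , y₁-sw , y₂-sw)
      with δ-target {g₁ = f y₁ v} {h₁ = f y₁ u} {g₂ = f y₂ v} {h₂ = f y₂ u} p≢q
                    (balance y₁≢y₂ y₁-sw y₂-sw)
    ... | inj₂ fy₂u≡q = chain y₁≢y₂ y₁-sw y₂-sw fy₂u≡q
    ... | inj₁ fy₁u≡q = chain (≢-sym y₁≢y₂) y₂-sw y₁-sw fy₁u≡q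

nonZeroEntries≡# : ∀ {k} (v : Demand k) → nonZeroEntries v ≡ # (λ j → ¬? (lookup v j ≟ 0))
nonZeroEntries≡# v =
  trans (cong (count (λ x → ¬? (x ≟ 0))) (sym (tabulate∘lookup v))) (count-tabulate _ (lookup v))

positive-demand-outside : ∀ {k} (v : Demand k) → 4 ≤ nonZeroEntries v →
  ∀ x y z → ∃[ s ] 1 ≤ lookup v s × s ≢ x × s ≢ y × s ≢ z
positive-demand-outside v 4≤nz x y z with #-pos⇒∃ (nz? ∖? x ∖? y ∖? z) 0<#
  where
  nz? = λ j → ¬? (lookup v j ≟ 0)
  0<# : 0 < # (nz? ∖? x ∖? y ∖? z)
  0<# = #-remove-≥ (nz? ∖? x ∖? y) z (#-remove-≥ (nz? ∖? x) y (#-remove-≥ nz? x 4≤#))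
    where 4≤# = subst (4 ≤_) (nonZeroEntries≡# v) 4≤nz
... | s , ((vs≢0 , s≢x) , s≢y) , s≢z = s , n≢0⇒n>0 vs≢0 , s≢x , s≢y , s≢z

m≢0⇒m≤2⇒m≡1⊎m≡2 : ∀ {c} → c ≢ 0 → c ≤ 2 → c ≡ 1 ⊎ c ≡ 2
m≢0⇒m≤2⇒m≡1⊎m≡2 {zero} c≢0 _ = contradiction refl c≢0
m≢0⇒m≤2⇒m≡1⊎m≡2 {suc zero} _ _ = inj₁ refl
m≢0⇒m≤2⇒m≡1⊎m≡2 {suc (suc zero)} _ _ = inj₂ refl
m≢0⇒m≤2⇒m≡1⊎m≡2 {suc (suc (suc _))} _ (s≤s (s≤s ()))

module _ {n k} {f : Allocation n k} (valid : Valid f) (maxCost : MaxSwitchingCostAtMost f 2) where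

  no-intermediate⇒switchingCost≡1 : ∀ {v u : Demand k} {p q} → IsDemand n v → Adjacent v u p q →
    (∃[ m ] IntermediateTask f v u p q m → ⊥) → switchingCost f v u ≡ 1
  no-intermediate⇒switchingCost≡1 dv adj no-intermediate
    with m≢0⇒m≤2⇒m≡1⊎m≡2 (switchingCost≢0 valid dv adj) (maxCost _ _ _ _ dv adj)
  ... | inj₁ cost≡1 = cost≡1
  ... | inj₂ cost≡2 = ⊥-elim (no-intermediate (switchingCost≡2⇒intermediate valid dv adj cost≡2))

  adjacent-switchers-among : ∀ {v u : Demand k} {p q} → IsDemand n v → Adjacent v u p q →
    ∀ {y₁ y₂} → y₁ ≢ y₂ → Switches f v u y₁ → Switches f v u y₂ →
    ∀ {x} → Switches f v u x → x ≡ y₁ ⊎ x ≡ y₂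
  adjacent-switchers-among {v} {u} dv adj =
    #≤2⇒among (switches? f v u) (subst (_≤ 2) (switchingCost≡# f v u) (maxCost _ _ _ _ dv adj))

  no-three-switchers : ∀ {v u : Demand k} {p q} → IsDemand n v → Adjacent v u p q →
    ∀ {x y z} → x ≢ y → x ≢ z → y ≢ z →
    Switches f v u x → Switches f v u y → Switches f v u z → ⊥
  no-three-switchers dv adj x≢y x≢z y≢z x-sw y-sw z-sw =
    [ x≢z ∘ sym , y≢z ∘ sym ]′ (adjacent-switchers-among dv adj x≢y x-sw y-sw z-sw)

  no-detour-to-intermediate : ∀ {v : Demand k} {s i t m a b} → IsDemand n v → s ≢ t → 1 ≤ lookup v s →
    IntermediateTask f v (move v s i) s i m →
    Mobile f b v (move v s t) s i → Mobile f a v (move v s t) i t → ⊥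
  no-detour-to-intermediate {v} {s} {i} {t} {m} {a} {b} dv s≢t 1≤vs
    (c , d , c≢d , c-mob@(fcv≡s , fcu≡m , s≢m) , d-mob@(fdv≡m , fdu≡i , m≢i))
    b-mob@(fbv≡s , fbw≡i , s≢i) a-mob@(fav≡i , faw≡t , i≢t) =
    no-three-switchers (Adjacent⇒IsDemand dv adj-vu) adj-uw a≢c a≢d c≢d a-sw c-sw d-sw
    where
    u = move v s i
    w = move v s t
    adj-vu : Adjacent v u s i
    adj-vu = s≢i , 1≤vs , refl
    adj-uw : Adjacent u w i t
    adj-uw = i≢t , lookup-move-to-pos v s≢i , sym (move-move-trans v s≢i i≢t s≢t 1≤vs)
    a≢b : a ≢ b
    a≢b refl = s≢i (trans (sym fbv≡s) fav≡i)
    a≢c : a ≢ c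
    a≢c refl = s≢i (trans (sym fcv≡s) fav≡i)
    a≢d : a ≢ d
    a≢d refl = m≢i (trans (sym fdv≡m) fav≡i)
    d≢b : d ≢ b
    d≢b refl = s≢m (trans (sym fbv≡s) fdv≡m)
    only-cd = adjacent-switchers-among dv adj-vu c≢d (Mobile⇒Switches f c-mob) (Mobile⇒Switches f d-mob)
    only-ab = adjacent-switchers-among dv (s≢t , 1≤vs , refl) a≢b
                (Mobile⇒Switches f a-mob) (Mobile⇒Switches f b-mob)
    a-sw : Switches f u w a
    a-sw = Mobile⇒Switches f (trans (sym (others-stay f only-cd a≢c a≢d)) fav≡i , faw≡t , i≢t)
    c-sw : Switches f u w c
    c-sw with c ≟ᶠ b
    ... | yes refl = Mobile⇒Switches f (fcu≡m , fbw≡i , m≢i)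
    ... | no c≢b = Mobile⇒Switches f (fcu≡m , fcw≡s , ≢-sym s≢m)
      where fcw≡s = trans (sym (others-stay f only-ab (≢-sym a≢c) c≢b)) fcv≡s
    d-sw : Switches f u w d
    d-sw = Mobile⇒Switches f (fdu≡i , fdw≡m , ≢-sym m≢i)
      where fdw≡m = trans (sym (others-stay f only-ab (≢-sym a≢d) d≢b)) fdv≡m

  direct-move-blocks-detour : ∀ {v : Demand k} {s t i m} → IsDemand n v →
    s ≢ i → s ≢ t → s ≢ m → t ≢ i → 1 ≤ lookup v s → 1 ≤ lookup v t →
    switchingCost f v (move v s i) ≡ 1 → IntermediateTask f v (move v t i) t i m → ⊥
  direct-move-blocks-detour {v} {s} {t} {i} dv s≢i s≢t s≢m t≢i 1≤vs 1≤vt direct-cost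
    (c , d , c≢d , c-mob@(fcv≡t , fcu≡m , t≢m) , d-mob@(fdv≡m , fdu≡i , m≢i))
    with switchingCost≡1⇒mobile valid dv (s≢i , 1≤vs , refl) direct-cost
  ... | y , (fyv≡s , fyr≡i , _) , only-y =
    no-three-switchers (Adjacent⇒IsDemand dv adj-vr) adj-ru c≢d c≢y d≢y c-sw d-sw y-sw
    where
    r = move v s i
    u = move v t i
    adj-vr : Adjacent v r s i
    adj-vr = s≢i , 1≤vs , refl
    adj-ru : Adjacent r u t s
    adj-ru = ≢-sym s≢t , subst (1 ≤_) (sym (lookup-move-other v s≢i (≢-sym s≢t) t≢i)) 1≤vt
           , sym (move-then-refill v s≢i (≢-sym s≢t) t≢i 1≤vs 1≤vt)
    c≢y : c ≢ y
    c≢y refl = s≢t (trans (sym fyv≡s) fcv≡t)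
    d≢y : d ≢ y
    d≢y refl = s≢m (trans (sym fyv≡s) fdv≡m)
    only-cd = adjacent-switchers-among dv (t≢i , 1≤vt , refl) c≢d
                (Mobile⇒Switches f c-mob) (Mobile⇒Switches f d-mob)
    c-sw : Switches f r u c
    c-sw = Mobile⇒Switches f (trans (sym (others-stay f (inj₁ ∘ only-y) c≢y c≢y)) fcv≡t , fcu≡m , t≢m)
    d-sw : Switches f r u d
    d-sw = Mobile⇒Switches f (trans (sym (others-stay f (inj₁ ∘ only-y) d≢y d≢y)) fdv≡m , fdu≡i , m≢i)
    y-sw : Switches f r u y
    y-sw = Mobile⇒Switches f (fyr≡i , fyu≡s , ≢-sym s≢i)
      where fyu≡s = trans (sym (others-stay f only-cd (≢-sym c≢y) (≢-sym d≢y))) fyv≡s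

lemma17 : ∀ (n k : ℕ) → 4 ≤ n → 5 ≤ k →
    (f : Allocation n k) → Valid f → MaxSwitchingCostAtMost f 2 →
    (v : Demand k) → IsDemand n v → 4 ≤ nonZeroEntries v →
    (t i : Fin k) (a : Fin n) → Type2With f v t i a →
    Type1 f v i
lemma17 n k _ _ f valid maxCost v dv 4≤nz t i a type2 = type1
  where
  from-other : ∀ {s} → s ≢ i → s ≢ t → 1 ≤ lookup v s → switchingCost f v (move v s i) ≡ 1
  from-other s≢i s≢t 1≤vs =
    no-intermediate⇒switchingCost≡1 valid maxCost dv (s≢i , 1≤vs , refl) λ (_ , detour) →
      let (_ , (_ , _ , _ , b-mob , _) , a-mob) = type2 _ s≢i s≢t 1≤vs
      in no-detour-to-intermediate valid maxCost dv s≢t 1≤vs detour b-mob a-mob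
  from-t : t ≢ i → 1 ≤ lookup v t → switchingCost f v (move v t i) ≡ 1
  from-t t≢i 1≤vt =
    no-intermediate⇒switchingCost≡1 valid maxCost dv (t≢i , 1≤vt , refl) λ (m , detour) →
      let (_ , 1≤vs , s≢i , s≢t , s≢m) = positive-demand-outside v 4≤nz i t m
      in direct-move-blocks-detour valid maxCost dv s≢i s≢t s≢m t≢i 1≤vs 1≤vt
           (from-other s≢i s≢t 1≤vs) detour
  type1 : Type1 f v i
  type1 s s≢i 1≤vs with s ≟ᶠ t
  ... | no s≢t = from-other s≢i s≢t 1≤vs
  ... | yes refl = from-t s≢i 1≤vs
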